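{- Let $G$ be a graph and $v_0\in V(G)$. A divisor $D\in\operatorname{Div}(G)$ is $v_0$-reduced if and only if $D^\star=K^+-D$ is $v_0$-critical.
   Context: A graph is a finite connected multigraph with no loop edges, $n=|V(G)|$, $\deg(v)$ the number of edges at $v$. $\operatorname{Div}(G)$ is the free abelian group on $V(G)$. For $f:V(G)\to\mathbb{Z}$, $\Delta(f)=\sum_v\big(\sum_{e=vw\in E_v}(f(v)-f(w))\big)(v)$; $\chi_A$ is the characteristic function of $A\subseteq V(G)$. For $A\subseteq V(G)$, $v\in A$, $\operatorname{outdeg}_A(v)$ is the number of edges from $v$ to $V(G)-A$. $D$ is $v_0$-reduced if $D(v)\ge0$ for all $v\ne v_0$ and every non-empty $A\subseteq V(G)-\{v_0\}$ contains $v$ with $D(v)<\operatorname{outdeg}_A(v)$. $K^+=\sum_v(\deg(v)-1)(v)$. A divisor $D$ is $v_0$-critical with respect to an ordering $v_1,\dots,v_{n-1}$ of $V(G)-\{v_0\}$ if $0\le D(v)\le\deg(v)-1$ for every $v\ne v_0$, and for every $1\le k\le n-1$ and every $v\ne v_0$ we have $D_k(v)\ge0$, where $D_k=D-\sum_{i=0}^{k}\Delta(\chi_{\{v_i\}})$. $D$ is $v_0$-critical if it is $v_0$-critical with respect to some ordering of $V(G)-\{v_0\}$. -}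

module Defs where

open import Data.Nat as ℕ using (ℕ; zero; suc; _≤?_)
open import Data.Integer as ℤ using (ℤ; +_; _-_; _*_; _<_; _≤_)
open import Data.Fin using (Fin; zero; suc; toℕ; _≟_)
open import Data.Fin.Subset using (Subset; ⁅_⁆; _∈_; _∉_; Nonempty)
open import Data.Vec using (lookup)
open import Data.Bool using (Bool; true; false; if_then_else_)
open import Data.Product using (Σ; ∃; _×_; _,_)
open import Relation.Binary.PropositionalEquality using (_≡_; _≢_)
open import Relation.Nullary.Decidable using (⌊_⌋)
open import Function.Definitions using (Injective)

sumℕ : ∀ {n} → (Fin n → ℕ) → ℕ
sumℕ {zero}  f = 0
sumℕ {suc n} f = f zero ℕ.+ sumℕ (λ i → f (suc i))

sumℤ : ∀ {n} → (Fin n → ℤ) → ℤ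
sumℤ {zero}  f = + 0
sumℤ {suc n} f = f zero ℤ.+ sumℤ (λ i → f (suc i))

record Graph (n : ℕ) : Set where
  field
    mult   : Fin n → Fin n → ℕ
    sym    : ∀ u v → mult u v ≡ mult v u
    noLoop : ∀ v → mult v v ≡ 0

open Graph public

data Reach {n} (G : Graph n) : Fin n → Fin n → Set where
  here : ∀ {v} → Reach G v v
  step : ∀ {u w v} → 0 ℕ.< mult G u w → Reach G w v → Reach G u v

Connected : ∀ {n} → Graph n → Set
Connected G = ∀ u v → Reach G u v

Divisor : ℕ → Set
Divisor n = Fin n → ℤ

deg : ∀ {n} → Graph n → Fin n → ℕ
deg G v = sumℕ (λ w → mult G v w)

Δ : ∀ {n} → Graph n → (Fin n → ℤ) → Divisor n
Δ G f v = sumℤ (λ w → + mult G v w * (f v - f w))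

χ : ∀ {n} → Subset n → Fin n → ℤ
χ A w = if lookup A w then + 1 else + 0

outdeg : ∀ {n} → Graph n → Subset n → Fin n → ℕ
outdeg G A v = sumℕ (λ w → if lookup A w then 0 else mult G v w)

K⁺ : ∀ {n} → Graph n → Divisor n
K⁺ G v = + deg G v - + 1

_-ᴰ_ : ∀ {n} → Divisor n → Divisor n → Divisor n
(D -ᴰ E) v = D v - E v

Reduced : ∀ {n} → Graph n → Fin n → Divisor n → Set
Reduced G v₀ D =
  (∀ v → v ≢ v₀ → + 0 ≤ D v) ×
  (∀ (A : Subset _) → Nonempty A → v₀ ∉ A →
     ∃ λ v → v ∈ A × D v < + outdeg G A v)

-- An ordering v₀, v₁, …, v_{n-1} of V(G) starting at v₀ is given by an
-- injective (hence bijective) σ : Fin (suc m) → Fin (suc m) with σ 0 = v₀;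
-- v_i = σ i.
-- D_k = D - Σ_{i=0}^{k} Δ(χ_{v_i})
Dk : ∀ {m} → Graph (suc m) → (Fin (suc m) → Fin (suc m)) → Divisor (suc m) → ℕ → Divisor (suc m)
Dk G σ D k v = D v - sumℤ (λ i → if ⌊ toℕ i ≤? k ⌋ then Δ G (χ ⁅ σ i ⁆) v else + 0)

CriticalWrt : ∀ {m} → Graph (suc m) → Fin (suc m) → (Fin (suc m) → Fin (suc m)) → Divisor (suc m) → Set
CriticalWrt {m} G v₀ σ D =
  (∀ v → v ≢ v₀ → (+ 0 ≤ D v) × (D v ≤ + deg G v - + 1)) ×
  (∀ k → 1 ℕ.≤ k → k ℕ.≤ m → ∀ v → v ≢ v₀ → + 0 ≤ Dk G σ D k v)

Critical : ∀ {m} → Graph (suc m) → Fin (suc m) → Divisor (suc m) → Set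
Critical {m} G v₀ D =
  Σ (Fin (suc m) → Fin (suc m)) λ σ →
    Injective _≡_ _≡_ σ × σ zero ≡ v₀ × CriticalWrt G v₀ σ D

-- Write D* = K⁺ - D and S_k = {v₀, …, v_k}. Firing v₀, …, v_k one after the other is firing the
-- set S_k, so D*_k = D* - Δ(χ S_k). At v ∈ S_k this is (edges from v into S_k) - 1 - D(v), and at
-- v ∉ S_k it is at least D*(v). Hence D* is v₀-critical for the order iff 0 ≤ D(v) < deg(v) off v₀
-- and every S_k "burns": each of its vertices other than v₀ has more than D(v) edges into S_k.
-- If D is reduced, Dhar's burning algorithm builds such an order: for the unburnt set A,
-- reducedness gives v ∈ A with more than D(v) edges out of A, i.e. into the burnt set. Conversely,
-- given a critical order and A ∌ v₀, the first vertex of A in the order has more than D(v) edges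
-- into the vertices before it, all of which lie outside A.

module Submission where

open import Defs hiding (sym)
open import Algebra.Properties.CommutativeMonoid.Sum as MonoidSum using ()
open import Data.Bool using (Bool; true; false; not; if_then_else_)
open import Data.Bool.Properties using (¬-not)
open import Data.Fin using (Fin; zero; suc; toℕ; _≟_; punchIn; inject; fromℕ<)
open import Data.Fin.Permutation.Components using (transpose; transpose-inverse)
import Data.Fin.Properties as Finₚ
open Finₚ using (any?)
open import Data.Fin.Subset using (Subset; ⁅_⁆; _∈_; _∉_; _⊆_; ∁; Nonempty)
open import Data.Fin.Subset.Properties
  using (_∈?_; x∈⁅x⁆; x∈⁅y⁆⇒x≡y; x∉p⇒x∈∁p; x∈p⇒x∉∁p; x∈∁p⇒x∉p; p⊆q⇒∁p⊇∁q)
open import Data.Integer as ℤ using (ℤ; +_; -_; _+_; _-_; _*_; _≤_; _<_)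
import Data.Integer.Properties as ℤₚ
open import Data.Integer.Tactic.RingSolver using (solve-∀)
open import Data.Nat as ℕ using (ℕ; zero; suc)
import Data.Nat.Properties as ℕₚ
open import Data.Product using (∃; _×_; _,_; proj₁; proj₂)
open import Data.Sum as Sum using (_⊎_; inj₁; inj₂)
open import Data.Vec using (lookup; tabulate)
open import Data.Vec.Properties using (lookup∘tabulate; lookup-map; lookup⇒[]=; []=⇒lookup)
open import Function using (_∘_; _⇔_; mk⇔; Equivalence)
open import Function.Definitions using (Injective)
open import Relation.Binary.PropositionalEquality
open import Relation.Nullary using (¬_; Dec; yes; no; does; contradiction)
open import Relation.Nullary.Decidable using (⌊_⌋; ¬?; _×-dec_; dec-true; dec-false; decidable-stable)
open import Relation.Unary using (Pred; Decidable)

private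
  module ℕΣ = MonoidSum ℕₚ.+-0-commutativeMonoid
  module ℤΣ = MonoidSum ℤₚ.+-0-commutativeMonoid

sumℕ≡sum : ∀ {n} (f : Fin n → ℕ) → sumℕ f ≡ ℕΣ.sum f
sumℕ≡sum {zero}  f = refl
sumℕ≡sum {suc n} f = cong (f zero ℕ.+_) (sumℕ≡sum (f ∘ suc))

sumℤ≡sum : ∀ {n} (f : Fin n → ℤ) → sumℤ f ≡ ℤΣ.sum f
sumℤ≡sum {zero}  f = refl
sumℤ≡sum {suc n} f = cong (_+_ (f zero)) (sumℤ≡sum (f ∘ suc))

sumℕ-distrib-+ : ∀ {n} (f g : Fin n → ℕ) → sumℕ (λ i → f i ℕ.+ g i) ≡ sumℕ f ℕ.+ sumℕ g
sumℕ-distrib-+ f g = begin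
  sumℕ (λ i → f i ℕ.+ g i)    ≡⟨ sumℕ≡sum (λ i → f i ℕ.+ g i) ⟩
  ℕΣ.sum (λ i → f i ℕ.+ g i)  ≡⟨ ℕΣ.∑-distrib-+ f g ⟩
  ℕΣ.sum f ℕ.+ ℕΣ.sum g       ≡⟨ sym (cong₂ ℕ._+_ (sumℕ≡sum f) (sumℕ≡sum g)) ⟩
  sumℕ f ℕ.+ sumℕ g           ∎
  where open ≡-Reasoning

sumℕ-mono-≤ : ∀ {n} {f g : Fin n → ℕ} → (∀ i → f i ℕ.≤ g i) → sumℕ f ℕ.≤ sumℕ g
sumℕ-mono-≤ {zero}  f≤g = ℕ.z≤n
sumℕ-mono-≤ {suc n} f≤g = ℕₚ.+-mono-≤ (f≤g zero) (sumℕ-mono-≤ (f≤g ∘ suc))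

sumℕ-cong : ∀ {n} {f g : Fin n → ℕ} → (∀ i → f i ≡ g i) → sumℕ f ≡ sumℕ g
sumℕ-cong {zero}  f≗g = refl
sumℕ-cong {suc n} f≗g = cong₂ ℕ._+_ (f≗g zero) (sumℕ-cong (f≗g ∘ suc))

sumℤ-cong : ∀ {n} {f g : Fin n → ℤ} → (∀ i → f i ≡ g i) → sumℤ f ≡ sumℤ g
sumℤ-cong {zero}  f≗g = refl
sumℤ-cong {suc n} f≗g = cong₂ _+_ (f≗g zero) (sumℤ-cong (f≗g ∘ suc))

sumℤ-distrib-+ : ∀ {n} (f g : Fin n → ℤ) → sumℤ (λ i → f i + g i) ≡ sumℤ f + sumℤ g
sumℤ-distrib-+ f g = begin
  sumℤ (λ i → f i + g i)    ≡⟨ sumℤ≡sum (λ i → f i + g i) ⟩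
  ℤΣ.sum (λ i → f i + g i)  ≡⟨ ℤΣ.∑-distrib-+ f g ⟩
  ℤΣ.sum f + ℤΣ.sum g       ≡⟨ sym (cong₂ _+_ (sumℤ≡sum f) (sumℤ≡sum g)) ⟩
  sumℤ f + sumℤ g           ∎
  where open ≡-Reasoning

sumℤ-zeros : ∀ {n} {f : Fin n → ℤ} → (∀ i → f i ≡ + 0) → sumℤ f ≡ + 0
sumℤ-zeros {n} f≗0 = trans (sumℤ-cong f≗0) (trans (sumℤ≡sum {n} (λ _ → + 0)) (ℤΣ.sum-replicate-zero n))

sumℤ-single : ∀ {n} (f : Fin n → ℤ) j → (∀ i → i ≢ j → f i ≡ + 0) → sumℤ f ≡ f j
sumℤ-single {suc n} f j others = begin
  sumℤ f                        ≡⟨ sumℤ≡sum f ⟩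
  ℤΣ.sum f                      ≡⟨ ℤΣ.sum-remove f ⟩
  f j + ℤΣ.sum (f ∘ punchIn j)  ≡⟨ cong (_+_ (f j)) (sym (sumℤ≡sum (f ∘ punchIn j))) ⟩
  f j + sumℤ (f ∘ punchIn j)    ≡⟨ cong (_+_ (f j)) (sumℤ-zeros λ i → others _ (Finₚ.punchInᵢ≢i j i)) ⟩
  f j + + 0                     ≡⟨ ℤₚ.+-identityʳ (f j) ⟩
  f j                           ∎
  where open ≡-Reasoning

pos-sumℕ : ∀ {n} (f : Fin n → ℕ) → + sumℕ f ≡ sumℤ (λ i → + f i)
pos-sumℕ {zero}  f = refl
pos-sumℕ {suc n} f = trans (ℤₚ.pos-+ (f zero) _) (cong (_+_ (+ f zero)) (pos-sumℕ (f ∘ suc)))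

least-index : ∀ {n p} {P : Pred (Fin n) p} → Decidable P → ∃ P →
              ∃ λ k → P k × (∀ i → toℕ i ℕ.< toℕ k → ¬ P i)
least-index {n} {P = P} P? (i , Pi)
  with k , ¬¬Pk , earlier ← Finₚ.¬∀⟶∃¬-smallest n (¬_ ∘ P) (¬? ∘ P?) (λ ∀¬P → ∀¬P i Pi) =
  k , decidable-stable (P? k) ¬¬Pk , λ j j<k → subst (¬_ ∘ P) (inject-fromℕ< j<k) (earlier (fromℕ< j<k))
  where
  inject-fromℕ< : ∀ {k} {j : Fin n} (j<k : toℕ j ℕ.< toℕ k) → inject (fromℕ< j<k) ≡ j
  inject-fromℕ< j<k = Finₚ.toℕ-injective (trans (Finₚ.toℕ-inject _) (Finₚ.toℕ-fromℕ< j<k))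

injective⇒surjective : ∀ {n} {σ : Fin n → Fin n} → Injective _≡_ _≡_ σ → ∀ w → ∃ λ i → σ i ≡ w
injective⇒surjective {suc n} {σ} inj w with any? (λ i → σ i ≟ w)
... | yes hit  = hit
... | no  miss = contradiction (λ {i} {j} eq → inj (Finₚ.punchOut-injective (w≢σ i) (w≢σ j) eq))
                               (Finₚ.<⇒notInjective (ℕₚ.n<1+n n))
  where
  w≢σ : ∀ i → w ≢ σ i
  w≢σ i w≡σi = miss (i , sym w≡σi)

module _ {n} {i j : Fin n} where

  transpose-injective : Injective _≡_ _≡_ (transpose i j)
  transpose-injective eq =
    trans (sym (transpose-inverse j i)) (trans (cong (transpose j i) eq) (transpose-inverse j i))

  transpose-matchˡ : transpose i j i ≡ j
  transpose-matchˡ rewrite dec-true (i ≟ i) refl = refl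

  transpose-other : ∀ {k} → k ≢ i → k ≢ j → transpose i j k ≡ k
  transpose-other {k} k≢i k≢j rewrite dec-false (k ≟ i) k≢i | dec-false (k ≟ j) k≢j = refl

0≤x-1-d⇔d<x : ∀ x d → (+ 0 ≤ x - + 1 - d) ⇔ (d < x)
0≤x-1-d⇔d<x x d = mk⇔
  (λ 0≤ → ℤₚ.suc[i]≤j⇒i<j (ℤₚ.0≤i-j⇒j≤i (subst (+ 0 ≤_) (shift x d) 0≤)))
  (λ d<x → subst (+ 0 ≤_) (sym (shift x d)) (ℤₚ.i≤j⇒0≤j-i (ℤₚ.i<j⇒suc[i]≤j d<x)))
  where
  shift : ∀ x d → x - + 1 - d ≡ x - (+ 1 + d)
  shift = solve-∀

x-d≤x⇔0≤d : ∀ x d → (x - d ≤ x) ⇔ (+ 0 ≤ d)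
x-d≤x⇔0≤d x d = mk⇔
  (λ x-d≤x → subst (+ 0 ≤_) (cancel x d) (ℤₚ.i≤j⇒0≤j-i x-d≤x))
  (λ 0≤d → ℤₚ.0≤i-j⇒j≤i (subst (+ 0 ≤_) (sym (cancel x d)) 0≤d))
  where
  cancel : ∀ x d → x - (x - d) ≡ d
  cancel = solve-∀

lookup-∉ : ∀ {n} {S : Subset n} {w} → w ∉ S → lookup S w ≡ false
lookup-∉ {S = S} {w} w∉S = ¬-not (w∉S ∘ lookup⇒[]= w S)

χ-∈ : ∀ {n} {S : Subset n} {w} → w ∈ S → χ S w ≡ + 1
χ-∈ w∈S rewrite []=⇒lookup w∈S = refl

χ-∉ : ∀ {n} {S : Subset n} {w} → w ∉ S → χ S w ≡ + 0
χ-∉ w∉S rewrite lookup-∉ w∉S = refl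

χ+χ∁≡1 : ∀ {n} (S : Subset n) w → χ S w + χ (∁ S) w ≡ + 1
χ+χ∁≡1 S w with w ∈? S
... | yes w∈S rewrite lookup-map w not S | []=⇒lookup w∈S = refl
... | no  w∉S rewrite lookup-map w not S | lookup-∉ w∉S = refl

image : ∀ {m n p} {P : Pred (Fin m) p} → Decidable P → (Fin m → Fin n) → Subset n
image P? σ = tabulate λ w → does (any? λ i → P? i ×-dec σ i ≟ w)

module _ {m n p} {P : Pred (Fin m) p} (P? : Decidable P) (σ : Fin m → Fin n) where

  ∈-image⁺ : ∀ {i} → P i → σ i ∈ image P? σ
  ∈-image⁺ {i} Pi = lookup⇒[]= (σ i) (image P? σ)
    (trans (lookup∘tabulate _ (σ i)) (dec-true (any? λ j → P? j ×-dec σ j ≟ σ i) (i , Pi , refl)))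

  ∈-image⁻ : ∀ {w} → w ∈ image P? σ → ∃ λ i → P i × σ i ≡ w
  ∈-image⁻ {w} w∈
    with any? (λ i → P? i ×-dec σ i ≟ w) | trans (sym (lookup∘tabulate _ w)) ([]=⇒lookup w∈)
  ... | yes found | _  = found
  ... | no  _     | ()

  sum-χ-image : Injective _≡_ _≡_ σ → ∀ w →
                sumℤ (λ i → if ⌊ P? i ⌋ then χ ⁅ σ i ⁆ w else + 0) ≡ χ (image P? σ) w
  sum-χ-image inj w with w ∈? image P? σ
  ... | no w∉ = trans (sumℤ-zeros term≡0) (sym (χ-∉ w∉))
    where
    term≡0 : ∀ i → (if ⌊ P? i ⌋ then χ ⁅ σ i ⁆ w else + 0) ≡ + 0
    term≡0 i with P? i
    ... | yes Pi = χ-∉ λ w∈⁅σi⁆ → w∉ (subst (_∈ image P? σ) (sym (x∈⁅y⁆⇒x≡y _ w∈⁅σi⁆)) (∈-image⁺ Pi))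
    ... | no  _  = refl
  ... | yes w∈ with j , Pj , σj≡w ← ∈-image⁻ w∈ =
    trans (sumℤ-single _ j others) (trans term-j (sym (χ-∈ w∈)))
    where
    others : ∀ i → i ≢ j → (if ⌊ P? i ⌋ then χ ⁅ σ i ⁆ w else + 0) ≡ + 0
    others i i≢j with P? i
    ... | yes _ = χ-∉ λ w∈⁅σi⁆ → i≢j (inj (trans (sym (x∈⁅y⁆⇒x≡y _ w∈⁅σi⁆)) (sym σj≡w)))
    ... | no  _ = refl
    term-j : (if ⌊ P? j ⌋ then χ ⁅ σ j ⁆ w else + 0) ≡ + 1
    term-j with P? j
    ... | yes _   rewrite σj≡w = χ-∈ (x∈⁅x⁆ w)
    ... | no ¬Pj = contradiction Pj ¬Pj

burnt : ∀ {n} → (Fin n → Fin n) → ℕ → Subset n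
burnt σ k = image (λ i → toℕ i ℕ.≤? k) σ

∈-burnt⁺ : ∀ {n} (σ : Fin n → Fin n) {k i} → toℕ i ℕ.≤ k → σ i ∈ burnt σ k
∈-burnt⁺ σ {k} = ∈-image⁺ (λ i → toℕ i ℕ.≤? k) σ

∈-burnt⁻ : ∀ {n} (σ : Fin n → Fin n) {k w} → w ∈ burnt σ k → ∃ λ i → toℕ i ℕ.≤ k × σ i ≡ w
∈-burnt⁻ σ {k} = ∈-image⁻ (λ i → toℕ i ℕ.≤? k) σ

burnt-⊆ : ∀ {n} {σ τ : Fin n → Fin n} {k k′} →
          (∀ {i} → toℕ i ℕ.≤ k → ∃ λ i′ → toℕ i′ ℕ.≤ k′ × τ i′ ≡ σ i) → burnt σ k ⊆ burnt τ k′
burnt-⊆ {σ = σ} {τ} {k′ = k′} reindex w∈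
  with i , i≤k , σi≡w ← ∈-burnt⁻ σ w∈
  with i′ , i′≤k′ , τi′≡σi ← reindex i≤k =
  subst (_∈ burnt τ k′) (trans τi′≡σi σi≡w) (∈-burnt⁺ τ i′≤k′)

burnt-suc⁻ : ∀ {n} (σ : Fin n → Fin n) {k w} → w ∈ burnt σ (suc k) →
             w ∈ burnt σ k ⊎ ∃ λ i → toℕ i ≡ suc k × σ i ≡ w
burnt-suc⁻ σ w∈ with i , i≤sk , σi≡w ← ∈-burnt⁻ σ w∈ with ℕₚ.m≤n⇒m<n∨m≡n i≤sk
... | inj₁ (ℕ.s≤s i≤k) = inj₁ (subst (_∈ burnt σ _) σi≡w (∈-burnt⁺ σ i≤k))
... | inj₂ i≡sk        = inj₂ (i , i≡sk , σi≡w)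

module _ {n} (G : Graph n) where

  outdeg≤deg : ∀ S v → outdeg G S v ℕ.≤ deg G v
  outdeg≤deg S v = sumℕ-mono-≤ term
    where
    term : ∀ w → (if lookup S w then 0 else mult G v w) ℕ.≤ mult G v w
    term w with lookup S w
    ... | true  = ℕ.z≤n
    ... | false = ℕₚ.≤-refl

  -- The slack w ≡ v is harmless because G has no loops.
  outdeg-anti : ∀ {S T v} → (∀ {w} → w ∈ T → w ∈ S ⊎ w ≡ v) → outdeg G S v ℕ.≤ outdeg G T v
  outdeg-anti {S} {T} {v} T⊆S∪v = sumℕ-mono-≤ term
    where
    term : ∀ w → (if lookup S w then 0 else mult G v w) ℕ.≤ (if lookup T w then 0 else mult G v w)
    term w with w ∈? S | w ∈? T
    ... | yes w∈S | _       rewrite []=⇒lookup w∈S = ℕ.z≤n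
    ... | no  w∉S | no  w∉T rewrite lookup-∉ w∉S | lookup-∉ w∉T = ℕₚ.≤-refl
    ... | no  w∉S | yes w∈T with T⊆S∪v w∈T
    ...   | inj₁ w∈S  = contradiction w∈S w∉S
    ...   | inj₂ refl rewrite lookup-∉ w∉S | noLoop G w = ℕ.z≤n

  deg≡outdeg+outdeg∁ : ∀ S v → deg G v ≡ outdeg G S v ℕ.+ outdeg G (∁ S) v
  deg≡outdeg+outdeg∁ S v = trans (sumℕ-cong split) (sumℕ-distrib-+ {n} _ _)
    where
    split : ∀ w → mult G v w ≡ (if lookup S w then 0 else mult G v w)
                              ℕ.+ (if lookup (∁ S) w then 0 else mult G v w)
    split w rewrite lookup-map w not S with lookup S w
    ... | true  = refl
    ... | false = sym (ℕₚ.+-identityʳ (mult G v w))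

  Δ-cong : ∀ {f g : Fin n → ℤ} → (∀ w → f w ≡ g w) → ∀ v → Δ G f v ≡ Δ G g v
  Δ-cong f≗g v = sumℤ-cong λ w → cong₂ (λ a b → + mult G v w * (a - b)) (f≗g v) (f≗g w)

  Δ-const : ∀ c v → Δ G (λ _ → c) v ≡ + 0
  Δ-const c v = sumℤ-zeros λ w →
    trans (cong (+ mult G v w *_) (ℤₚ.+-inverseʳ c)) (ℤₚ.*-zeroʳ (+ mult G v w))

  Δ-+ : ∀ (f g : Fin n → ℤ) v → Δ G (λ w → f w + g w) v ≡ Δ G f v + Δ G g v
  Δ-+ f g v = trans (sumℤ-cong λ w → distrib (+ mult G v w) (f v) (g v) (f w) (g w))
                    (sumℤ-distrib-+ {n} _ _)
    where
    distrib : ∀ m a b c d → m * ((a + b) - (c + d)) ≡ m * (a - c) + m * (b - d)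
    distrib = solve-∀

  Δ-if : ∀ b (f : Fin n → ℤ) v → (if b then Δ G f v else + 0) ≡ Δ G (λ w → if b then f w else + 0) v
  Δ-if true  f v = refl
  Δ-if false f v = sym (Δ-const (+ 0) v)

  Δ-sum : ∀ {k} (f : Fin k → Fin n → ℤ) v →
          sumℤ (λ i → Δ G (f i) v) ≡ Δ G (λ w → sumℤ λ i → f i w) v
  Δ-sum {zero}  f v = sym (Δ-const (+ 0) v)
  Δ-sum {suc k} f v = trans (cong (_+_ (Δ G (f zero) v)) (Δ-sum (f ∘ suc) v))
                            (sym (Δ-+ (f zero) (λ w → sumℤ λ i → f (suc i) w) v))

  Δχ-∈ : ∀ {S v} → v ∈ S → Δ G (χ S) v ≡ + outdeg G S v
  Δχ-∈ {S} {v} v∈S = trans (sumℤ-cong term) (sym (pos-sumℕ {n} _))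
    where
    term : ∀ w → + mult G v w * (χ S v - χ S w) ≡ + (if lookup S w then 0 else mult G v w)
    term w with w ∈? S
    ... | yes w∈S rewrite χ-∈ v∈S | χ-∈ w∈S | []=⇒lookup w∈S = ℤₚ.*-zeroʳ (+ mult G v w)
    ... | no  w∉S rewrite χ-∈ v∈S | χ-∉ w∉S | lookup-∉ w∉S = ℤₚ.*-identityʳ (+ mult G v w)

  -- χ S and χ (∁ S) sum to a constant, which Δ kills.
  Δχ-∉ : ∀ {S v} → v ∉ S → Δ G (χ S) v ≡ - + outdeg G (∁ S) v
  Δχ-∉ {S} {v} v∉S = begin
    Δ G (χ S) v                                  ≡⟨ add-sub (Δ G (χ S) v) (Δ G (χ (∁ S)) v) ⟩
    (Δ G (χ S) v + Δ G (χ (∁ S)) v) - Δ G (χ (∁ S)) v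
      ≡⟨ cong₂ _-_ sum≡0 (Δχ-∈ (x∉p⇒x∈∁p v∉S)) ⟩
    + 0 - + outdeg G (∁ S) v                     ≡⟨ ℤₚ.+-identityˡ _ ⟩
    - + outdeg G (∁ S) v                         ∎
    where
    open ≡-Reasoning
    add-sub : ∀ a b → a ≡ (a + b) - b
    add-sub = solve-∀
    sum≡0 : Δ G (χ S) v + Δ G (χ (∁ S)) v ≡ + 0
    sum≡0 = trans (sym (Δ-+ (χ S) (χ (∁ S)) v))
                  (trans (Δ-cong (χ+χ∁≡1 S) v) (Δ-const (+ 1) v))

Dk≡firing-burnt : ∀ {m} (G : Graph (suc m)) {σ} → Injective _≡_ _≡_ σ →
                  ∀ E k v → Dk G σ E k v ≡ E v - Δ G (χ (burnt σ k)) v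
Dk≡firing-burnt G {σ} inj E k v = cong (_-_ (E v)) (begin
  sumℤ (λ i → if b i then Δ G (χ ⁅ σ i ⁆) v else + 0)
    ≡⟨ sumℤ-cong (λ i → Δ-if G (b i) (χ ⁅ σ i ⁆) v) ⟩
  sumℤ (λ i → Δ G (λ w → if b i then χ ⁅ σ i ⁆ w else + 0) v)
    ≡⟨ Δ-sum G (λ i w → if b i then χ ⁅ σ i ⁆ w else + 0) v ⟩
  Δ G (λ w → sumℤ λ i → if b i then χ ⁅ σ i ⁆ w else + 0) v
    ≡⟨ Δ-cong G (sum-χ-image (λ i → toℕ i ℕ.≤? k) σ inj) v ⟩
  Δ G (χ (burnt σ k)) v ∎)
  where
  open ≡-Reasoning
  b : Fin _ → Bool
  b i = ⌊ toℕ i ℕ.≤? k ⌋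

module _ {m} (G : Graph (suc m)) (v₀ : Fin (suc m)) (D : Divisor (suc m)) where

  -- outdeg G (∁ S) v is the number of edges from v into S.
  Burning : Subset (suc m) → Set
  Burning S = ∀ {v} → v ∈ S → v ≢ v₀ → D v < + outdeg G (∁ S) v

  burning-⊆ : ∀ {S T} → S ⊆ T → (∀ {w} → w ∈ T → w ≢ v₀ → D w < + outdeg G (∁ S) w) → Burning T
  burning-⊆ S⊆T ignites w∈T w≢v₀ =
    ℤₚ.<-≤-trans (ignites w∈T w≢v₀) (ℤ.+≤+ (outdeg-anti G (inj₁ ∘ p⊆q⇒∁p⊇∁q S⊆T)))

  firing-∈-nonneg⇔ : ∀ {S v} → v ∈ S → (+ 0 ≤ (K⁺ G -ᴰ D) v - Δ G (χ S) v) ⇔ (D v < + outdeg G (∁ S) v)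
  firing-∈-nonneg⇔ {S} {v} v∈S =
    subst (λ x → (+ 0 ≤ x) ⇔ (D v < + into)) (sym fired) (0≤x-1-d⇔d<x (+ into) (D v))
    where
    out = outdeg G S v
    into = outdeg G (∁ S) v
    cancel : ∀ a b d → ((a + b) - + 1 - d) - a ≡ b - + 1 - d
    cancel = solve-∀
    fired : (K⁺ G -ᴰ D) v - Δ G (χ S) v ≡ + into - + 1 - D v
    fired = begin
      (+ deg G v - + 1 - D v) - Δ G (χ S) v  ≡⟨ cong₂ (λ d δ → (d - + 1 - D v) - δ) deg≡ (Δχ-∈ G v∈S) ⟩
      ((+ out + + into) - + 1 - D v) - + out  ≡⟨ cancel (+ out) (+ into) (D v) ⟩
      + into - + 1 - D v                      ∎
      where
      open ≡-Reasoning
      deg≡ : + deg G v ≡ + out + + into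
      deg≡ = trans (cong +_ (deg≡outdeg+outdeg∁ G S v)) (ℤₚ.pos-+ out into)

  firing-∉-nonneg : ∀ {S v} → v ∉ S → D v < + deg G v → + 0 ≤ (K⁺ G -ᴰ D) v - Δ G (χ S) v
  firing-∉-nonneg {S} {v} v∉S D<deg =
    subst (λ δ → + 0 ≤ (K⁺ G -ᴰ D) v + δ) (sym (trans (cong -_ (Δχ-∉ G v∉S)) (ℤₚ.neg-involutive _)))
          (ℤₚ.+-mono-≤ (Equivalence.from (0≤x-1-d⇔d<x (+ deg G v) (D v)) D<deg) (ℤ.+≤+ ℕ.z≤n))

  criticalWrt⇒burning : ∀ {σ} → Injective _≡_ _≡_ σ → CriticalWrt G v₀ σ (K⁺ G -ᴰ D) →
                        ∀ {k} → 1 ℕ.≤ k → k ℕ.≤ m → Burning (burnt σ k)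
  criticalWrt⇒burning inj (_ , Dk≥0) {k} 1≤k k≤m {v} v∈S v≢v₀ =
    Equivalence.to (firing-∈-nonneg⇔ v∈S)
      (subst (+ 0 ≤_) (Dk≡firing-burnt G inj (K⁺ G -ᴰ D) k v) (Dk≥0 k 1≤k k≤m v v≢v₀))

  burning⇒criticalWrt : ∀ {σ} → Injective _≡_ _≡_ σ →
                        (∀ v → v ≢ v₀ → + 0 ≤ D v × D v < + deg G v) →
                        (∀ {k} → k ℕ.≤ m → Burning (burnt σ k)) →
                        CriticalWrt G v₀ σ (K⁺ G -ᴰ D)
  burning⇒criticalWrt {σ} inj bounded burning = bounds , Dk≥0
    where
    bounds : ∀ v → v ≢ v₀ → (+ 0 ≤ (K⁺ G -ᴰ D) v) × ((K⁺ G -ᴰ D) v ≤ + deg G v - + 1)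
    bounds v v≢v₀ with 0≤D , D<deg ← bounded v v≢v₀ =
      Equivalence.from (0≤x-1-d⇔d<x _ (D v)) D<deg , Equivalence.from (x-d≤x⇔0≤d _ (D v)) 0≤D
    Dk≥0 : ∀ k → 1 ℕ.≤ k → k ℕ.≤ m → ∀ v → v ≢ v₀ → + 0 ≤ Dk G σ (K⁺ G -ᴰ D) k v
    Dk≥0 k _ k≤m v v≢v₀ =
      subst (+ 0 ≤_) (sym (Dk≡firing-burnt G inj (K⁺ G -ᴰ D) k v)) (fired (v ∈? burnt σ k))
      where
      fired : Dec (v ∈ burnt σ k) → + 0 ≤ (K⁺ G -ᴰ D) v - Δ G (χ (burnt σ k)) v
      fired (yes v∈S) = Equivalence.from (firing-∈-nonneg⇔ v∈S) (burning k≤m v∈S v≢v₀)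
      fired (no  v∉S) = firing-∉-nonneg v∉S (proj₂ (bounded v v≢v₀))

  critical⇒reduced : Critical G v₀ (K⁺ G -ᴰ D) → Reduced G v₀ D
  critical⇒reduced (σ , inj , σ0≡v₀ , critical@(bounds , _)) = nonneg , ignites
    where
    nonneg : ∀ v → v ≢ v₀ → + 0 ≤ D v
    nonneg v v≢v₀ = Equivalence.to (x-d≤x⇔0≤d _ (D v)) (proj₂ (bounds v v≢v₀))

    ignites : ∀ A → Nonempty A → v₀ ∉ A → ∃ λ v → v ∈ A × D v < + outdeg G A v
    ignites A (a , a∈A) v₀∉A
      with i , σi≡a ← injective⇒surjective inj a
      with k , σk∈A , before ← least-index (λ i → σ i ∈? A) (i , subst (_∈ A) (sym σi≡a) a∈A) =
      σ k , σk∈A , ℤₚ.<-≤-trans D<into (ℤ.+≤+ (outdeg-anti G A⊆∁S∪σk))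
      where
      S = burnt σ (toℕ k)
      1≤k : 1 ℕ.≤ toℕ k
      1≤k = ℕₚ.n≢0⇒n>0 λ k≡0 → v₀∉A (subst (_∈ A) (trans (cong σ (Finₚ.toℕ-injective k≡0)) σ0≡v₀) σk∈A)
      D<into : D (σ k) < + outdeg G (∁ S) (σ k)
      D<into = criticalWrt⇒burning inj critical 1≤k (Finₚ.toℕ≤pred[n] k) (∈-burnt⁺ σ ℕₚ.≤-refl)
                 λ σk≡v₀ → v₀∉A (subst (_∈ A) σk≡v₀ σk∈A)
      A⊆∁S∪σk : ∀ {w} → w ∈ A → w ∈ ∁ S ⊎ w ≡ σ k
      A⊆∁S∪σk {w} w∈A with w ∈? S
      ... | no  w∉S = inj₁ (x∉p⇒x∈∁p w∉S)
      ... | yes w∈S with j , j≤k , σj≡w ← ∈-burnt⁻ σ w∈S with ℕₚ.m≤n⇒m<n∨m≡n j≤k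
      ...   | inj₁ j<k = contradiction (subst (_∈ A) (sym σj≡w) w∈A) (before j j<k)
      ...   | inj₂ j≡k = inj₂ (trans (sym σj≡w) (cong σ (Finₚ.toℕ-injective j≡k)))

  record BurningOrder (p : ℕ) : Set where
    field
      σ         : Fin (suc m) → Fin (suc m)
      injective : Injective _≡_ _≡_ σ
      σ-zero    : σ zero ≡ v₀
      burning   : ∀ {k} → k ℕ.≤ p → Burning (burnt σ k)

  initial : BurningOrder 0
  initial = record
    { σ         = transpose zero v₀
    ; injective = transpose-injective
    ; σ-zero    = transpose-matchˡ {i = zero} {j = v₀}
    ; burning   = only-v₀
    }
    where
    only-v₀ : ∀ {k} → k ℕ.≤ 0 → Burning (burnt (transpose zero v₀) k)
    only-v₀ ℕ.z≤n w∈S w≢v₀ with zero , _ , refl ← ∈-burnt⁻ (transpose zero v₀) w∈S =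
      contradiction (transpose-matchˡ {i = zero} {j = v₀}) w≢v₀

  module Extend (reduced : Reduced G v₀ D) {p} (p<m : p ℕ.< m) (order : BurningOrder p) where
    open BurningOrder order

    S : Subset (suc m)
    S = burnt σ p

    next : Fin (suc m)
    next = fromℕ< (ℕ.s≤s p<m)

    toℕ-next : toℕ next ≡ suc p
    toℕ-next = Finₚ.toℕ-fromℕ< (ℕ.s≤s p<m)

    σnext∉S : σ next ∉ S
    σnext∉S σnext∈S with i , i≤p , σi≡σnext ← ∈-burnt⁻ σ σnext∈S =
      ℕₚ.<-irrefl (trans (cong toℕ (injective σi≡σnext)) toℕ-next) (ℕ.s≤s i≤p)

    v₀∈S : v₀ ∈ S
    v₀∈S = subst (_∈ S) σ-zero (∈-burnt⁺ σ ℕ.z≤n)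

    ignition : ∃ λ v → v ∈ ∁ S × D v < + outdeg G (∁ S) v
    ignition = proj₂ reduced (∁ S) (σ next , x∉p⇒x∈∁p σnext∉S) (x∈p⇒x∉∁p v₀∈S)

    v : Fin (suc m)
    v = proj₁ ignition

    j : Fin (suc m)
    j = proj₁ (injective⇒surjective injective v)

    σj≡v : σ j ≡ v
    σj≡v = proj₂ (injective⇒surjective injective v)

    p<j : p ℕ.< toℕ j
    p<j = ℕₚ.≰⇒> λ j≤p → x∈∁p⇒x∉p (proj₁ (proj₂ ignition)) (subst (_∈ S) σj≡v (∈-burnt⁺ σ j≤p))

    σ′ : Fin (suc m) → Fin (suc m)
    σ′ = σ ∘ transpose next j

    σ′-next : σ′ next ≡ v
    σ′-next = trans (cong σ (transpose-matchˡ {i = next} {j = j})) σj≡v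

    σ′-old : ∀ {i} → toℕ i ℕ.≤ p → σ′ i ≡ σ i
    σ′-old {i} i≤p = cong σ (transpose-other
      (λ i≡next → ℕₚ.<-irrefl (trans (cong toℕ i≡next) toℕ-next) (ℕ.s≤s i≤p))
      (λ i≡j → ℕₚ.<-irrefl (cong toℕ i≡j) (ℕₚ.≤-<-trans i≤p p<j)))

    old⊆new : ∀ {k k′} → k ℕ.≤ p → k ℕ.≤ k′ → burnt σ k ⊆ burnt σ′ k′
    old⊆new k≤p k≤k′ = burnt-⊆ λ {i} i≤k → i , ℕₚ.≤-trans i≤k k≤k′ , σ′-old (ℕₚ.≤-trans i≤k k≤p)

    new⊆old : ∀ {k} → k ℕ.≤ p → burnt σ′ k ⊆ burnt σ k
    new⊆old k≤p = burnt-⊆ λ {i} i≤k → i , i≤k , sym (σ′-old (ℕₚ.≤-trans i≤k k≤p))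

    new⊆old∪v : ∀ {w} → w ∈ burnt σ′ (suc p) → w ∈ S ⊎ w ≡ v
    new⊆old∪v w∈ = Sum.map (new⊆old ℕₚ.≤-refl) is-v (burnt-suc⁻ σ′ w∈)
      where
      is-v : ∀ {w} → (∃ λ i → toℕ i ≡ suc p × σ′ i ≡ w) → w ≡ v
      is-v (i , i≡sp , σ′i≡w) =
        trans (sym σ′i≡w) (trans (cong σ′ (Finₚ.toℕ-injective (trans i≡sp (sym toℕ-next)))) σ′-next)

    burning-old : ∀ {k} → k ℕ.≤ p → Burning (burnt σ′ k)
    burning-old k≤p = burning-⊆ (old⊆new k≤p ℕₚ.≤-refl) λ w∈ → burning k≤p (new⊆old k≤p w∈)

    burning-new : Burning (burnt σ′ (suc p))
    burning-new = burning-⊆ (old⊆new ℕₚ.≤-refl (ℕₚ.n≤1+n p)) λ w∈ w≢v₀ →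
      Sum.[ (λ w∈S → burning ℕₚ.≤-refl w∈S w≢v₀)
          , (λ w≡v → subst (λ u → D u < + outdeg G (∁ S) u) (sym w≡v) (proj₂ (proj₂ ignition)))
          ] (new⊆old∪v w∈)

    burning′ : ∀ {k} → k ℕ.≤ suc p → Burning (burnt σ′ k)
    burning′ k≤sp = Sum.[ (λ k<sp → burning-old (ℕₚ.<⇒≤pred k<sp))
                        , (λ k≡sp → subst (Burning ∘ burnt σ′) (sym k≡sp) burning-new)
                        ] (ℕₚ.m≤n⇒m<n∨m≡n k≤sp)

    extended : BurningOrder (suc p)
    extended = record
      { σ         = σ′
      ; injective = transpose-injective ∘ injective
      ; σ-zero    = trans (σ′-old ℕ.z≤n) σ-zero
      ; burning   = burning′
      }

  burningOrder : Reduced G v₀ D → ∀ p → p ℕ.≤ m → BurningOrder p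
  burningOrder reduced zero    _   = initial
  burningOrder reduced (suc p) p<m = Extend.extended reduced p<m (burningOrder reduced p (ℕₚ.<⇒≤ p<m))

  reduced⇒critical : Reduced G v₀ D → Critical G v₀ (K⁺ G -ᴰ D)
  reduced⇒critical reduced@(nonneg , ignites) =
    σ , injective , σ-zero , burning⇒criticalWrt injective bounded burning
    where
    open BurningOrder (burningOrder reduced m ℕₚ.≤-refl)
    bounded : ∀ v → v ≢ v₀ → + 0 ≤ D v × D v < + deg G v
    bounded v v≢v₀ with u , u∈⁅v⁆ , D<out ← ignites ⁅ v ⁆ (v , x∈⁅x⁆ v) (v≢v₀ ∘ sym ∘ x∈⁅y⁆⇒x≡y v)
      rewrite x∈⁅y⁆⇒x≡y v u∈⁅v⁆ = nonneg v v≢v₀ , ℤₚ.<-≤-trans D<out (ℤ.+≤+ (outdeg≤deg G ⁅ v ⁆ v))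

lemma5p6 : ∀ {m} (G : Graph (suc m)) → Connected G → (v₀ : Fin (suc m)) (D : Divisor (suc m)) →
           Reduced G v₀ D ⇔ Critical G v₀ (K⁺ G -ᴰ D)
lemma5p6 G _ v₀ D = mk⇔ (reduced⇒critical G v₀ D) (critical⇒reduced G v₀ D)
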